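{- Let $\mathbf{x}$ be a reversal-closed sequence. Then $r_{\mathbf{x}}(n+1)+r_{\mathbf{x}}(n) \leq \rho_{\mathbf{x}}(n+1)+1$ for all $n\ge 0$.
   Context: A factor of a sequence is a finite contiguous block. For $u=u(1)\cdots u(m)$, $u^R=u(m)\cdots u(1)$. $\mathbf{x}$ is reversal-closed if $w^R$ is a factor for every factor $w$. $\rho_{\mathbf{x}}(n)$ is the number of distinct length-$n$ factors; $r_{\mathbf{x}}(n)$ the number of distinct length-$n$ factors up to $u\sim v\iff v\in\{u,u^R\}$. -}

module Defs where

open import Data.Nat using (ℕ; _+_)
open import Data.Fin using (Fin; toℕ)
open import Data.Vec using (Vec; tabulate; reverse)
open import Data.List using (List; length)
open import Data.List.Membership.Propositional using (_∈_)
open import Data.List.Relation.Unary.Unique.Propositional using (Unique)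
open import Data.List.Relation.Unary.AllPairs using (AllPairs)
open import Data.List.Relation.Unary.All using (All)
open import Data.List.Relation.Unary.Any using (Any)
open import Data.Product using (Σ; ∃; _×_)
open import Data.Sum using (_⊎_)
open import Relation.Binary.PropositionalEquality using (_≡_)
open import Relation.Nullary using (¬_)
open import Function.Bundles using (_⇔_)

Seq : ℕ → Set
Seq k = ℕ → Fin k

block : ∀ {k} → Seq k → ℕ → (n : ℕ) → Vec (Fin k) n
block x i n = tabulate (λ j → x (i + toℕ j))

IsFactor : ∀ {k} → Seq k → ∀ {n} → Vec (Fin k) n → Set
IsFactor x {n} w = ∃ λ i → w ≡ block x i n

ReversalClosed : ∀ {k} → Seq k → Set
ReversalClosed {k} x = ∀ n (w : Vec (Fin k) n) → IsFactor x w → IsFactor x (reverse w)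

_∼_ : ∀ {k n} → Vec (Fin k) n → Vec (Fin k) n → Set
u ∼ v = (v ≡ u) ⊎ (v ≡ reverse u)

FactorComplexity : ∀ {k} → Seq k → ℕ → ℕ → Set
FactorComplexity {k} x n m =
  Σ (List (Vec (Fin k) n)) λ L →
    (length L ≡ m) × Unique L × (∀ w → (w ∈ L) ⇔ IsFactor x w)

-- r_x(n) = m : there is a list of m length-n factors, pairwise inequivalent under ∼,
-- such that every length-n factor is ∼-equivalent to one of them
-- (i.e. m is the number of ∼-classes of length-n factors).
ReversalComplexity : ∀ {k} → Seq k → ℕ → ℕ → Set
ReversalComplexity {k} x n m =
  Σ (List (Vec (Fin k) n)) λ L →
    (length L ≡ m) × AllPairs (λ u v → ¬ (u ∼ v)) L × All (IsFactor x) L ×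
    (∀ w → IsFactor x w → Any (λ u → u ∼ w) L)

{-# OPTIONS --safe #-}
module Submission where

-- Regard the length-n factors, up to reversal, as vertices and the length-(n+1) factors as
-- edges: the factor starting at i joins the classes of the length-n factors starting at i and
-- at i + 1. Walking along x visits every vertex class. Whenever the walk reaches a new class,
-- the edge just used is not a palindrome (a palindromic edge joins a class to itself), so one
-- of its two orientations is a factor outside the list of representatives of the
-- (n+1)-classes; collect it. An edge collected earlier has both ends among the classes known
-- at that time, so the collected edges are distinct. Together with the representatives they
-- are r(n+1) + (r(n) - 1) distinct factors of length n + 1.

open import Defs
open import Data.Nat using (ℕ; zero; suc; _+_; _≤_; _⊔_; z≤n; s≤s)
open import Data.Nat.Properties
  using (≤-refl; ≤-trans; m≤m⊔n; m≤n⊔m; m≤n⇒m<n∨m≡n; +-suc; +-comm; +-monoʳ-≤; module ≤-Reasoning)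
open import Data.Fin using (Fin; toℕ; inject₁) renaming (_≟_ to _≟ᶠ_)
open import Data.Fin.Properties using (toℕ-inject₁)
open import Data.Vec using (Vec; tabulate; reverse; init; tail) renaming (_∷_ to _∷ᵥ_)
open import Data.Vec.Properties using (init-reverse; reverse-involutive; reverse-reverse; tabulate-cong; ≡-dec)
open import Data.List using (List; []; _∷_; [_]; length; _++_)
open import Data.List.Properties using (length-removeAt′; length-++)
open import Data.List.Relation.Unary.Any as Any using (Any; here; there)
open import Data.List.Relation.Unary.All as All using (All; []; _∷_)
open import Data.List.Relation.Unary.All.Properties using (++⁺)
open import Data.List.Relation.Unary.AllPairs as AllPairs using ([]; _∷_)
import Data.List.Relation.Unary.Unique.Setoid as SetoidUnique
open import Data.List.Relation.Unary.Unique.Propositional using (Unique)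
import Data.List.Relation.Unary.Unique.Propositional.Properties as Unique
import Data.List.Membership.Setoid as SetoidMembership
open import Data.List.Membership.Setoid.Properties using (∈-resp-≈)
open import Data.List.Membership.Propositional using (_∈_; _∉_)
open import Data.Product using (∃; _×_; _,_; proj₁; proj₂)
open import Data.Sum using (inj₁; inj₂)
open import Data.Empty using (⊥-elim)
open import Level using (0ℓ)
open import Relation.Binary.Bundles using (Setoid)
import Relation.Binary.PropositionalEquality as ≡
open import Relation.Binary.PropositionalEquality
  using (_≡_; _≢_; refl; sym; trans; cong; subst; subst₂; module ≡-Reasoning)
open import Relation.Nullary using (¬_; Dec; yes; no)
open import Relation.Nullary.Decidable using (_⊎-dec_)
open import Function.Bundles using (Equivalence)

module _ {c ℓ} (S : Setoid c ℓ) where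
  open Setoid S using (_≈_) renaming (sym to ≈-sym; trans to ≈-trans)
  open SetoidMembership S using (_─_) renaming (_∈_ to _∈ₛ_)
  open SetoidUnique S renaming (Unique to Uniqueₛ)

  ∈ₛ-remove : ∀ {x y ys} (x∈ys : x ∈ₛ ys) → y ∈ₛ ys → ¬ x ≈ y → y ∈ₛ (ys ─ x∈ys)
  ∈ₛ-remove (here x≈z)   (here y≈z)   x≉y = ⊥-elim (x≉y (≈-trans x≈z (≈-sym y≈z)))
  ∈ₛ-remove (here _)     (there y∈ys) _   = y∈ys
  ∈ₛ-remove (there _)    (here y≈z)   _   = here y≈z
  ∈ₛ-remove (there x∈ys) (there y∈ys) x≉y = there (∈ₛ-remove x∈ys y∈ys x≉y)

  unique-⊆⇒length-≤ : ∀ {xs ys} → Uniqueₛ xs → All (_∈ₛ ys) xs → length xs ≤ length ys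
  unique-⊆⇒length-≤ [] [] = z≤n
  unique-⊆⇒length-≤ {x ∷ xs} {ys} (x≉xs ∷ xs-unique) (x∈ys ∷ xs⊆ys) = begin
    length (x ∷ xs)          ≤⟨ s≤s (unique-⊆⇒length-≤ xs-unique (All.zipWith removal (x≉xs , xs⊆ys))) ⟩
    suc (length (ys ─ x∈ys)) ≡⟨ length-removeAt′ ys (Any.index x∈ys) ⟨
    length ys                ∎
    where
      open ≤-Reasoning
      removal : ∀ {y} → ¬ x ≈ y × y ∈ₛ ys → y ∈ₛ (ys ─ x∈ys)
      removal (x≉y , y∈ys) = ∈ₛ-remove x∈ys y∈ys x≉y

  unique-∈-≈⇒≡ : ∀ {xs x y} → Uniqueₛ xs → x ∈ xs → y ∈ xs → x ≈ y → x ≡ y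
  unique-∈-≈⇒≡ _            (here refl) (here refl) _   = refl
  unique-∈-≈⇒≡ (x≉xs ∷ _)   (here refl) (there y∈xs) x≈y = ⊥-elim (All.lookup x≉xs y∈xs x≈y)
  unique-∈-≈⇒≡ (y≉xs ∷ _)   (there x∈xs) (here refl) x≈y = ⊥-elim (All.lookup y≉xs x∈xs (≈-sym x≈y))
  unique-∈-≈⇒≡ (_ ∷ unique) (there x∈xs) (there y∈xs) x≈y = unique-∈-≈⇒≡ unique x∈xs y∈xs x≈y

witnesses-bounded : ∀ {A : Set} {P : A → ℕ → Set} (xs : List A) →
  All (λ a → ∃ (P a)) xs → ∃ λ N → All (λ a → ∃ λ i → i ≤ N × P a i) xs
witnesses-bounded []       []               = 0 , []
witnesses-bounded (_ ∷ xs) ((i , p) ∷ ps) with witnesses-bounded xs ps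
... | N , qs = i ⊔ N , (i , m≤m⊔n i N , p) ∷ All.map (λ (j , j≤N , q) → j , ≤-trans j≤N (m≤n⊔m i N) , q) qs

≤-suc-extend : ∀ {P : ℕ → Set} {N} → (∀ {i} → i ≤ N → P i) → P (suc N) → ∀ {i} → i ≤ suc N → P i
≤-suc-extend below top i≤1+N with m≤n⇒m<n∨m≡n i≤1+N
... | inj₁ (s≤s i≤N) = below i≤N
... | inj₂ refl      = top

init-tabulate : ∀ {A : Set} {m} (f : Fin (suc m) → A) → init (tabulate f) ≡ tabulate (λ j → f (inject₁ j))
init-tabulate {m = zero}  f = refl
init-tabulate {m = suc m} f = cong (f Fin.zero ∷ᵥ_) (init-tabulate (λ j → f (Fin.suc j)))

tail-reverse : ∀ {A : Set} {m} (u : Vec A (suc m)) → tail (reverse u) ≡ reverse (init u)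
tail-reverse u = sym (reverse-reverse (begin
  reverse (tail (reverse u)) ≡⟨ init-reverse (reverse u) ⟨
  init (reverse (reverse u)) ≡⟨ cong init (reverse-involutive u) ⟩
  init u                     ∎))
  where open ≡-Reasoning

module _ {k : ℕ} where

  ∼-refl : ∀ {m} {u : Vec (Fin k) m} → u ∼ u
  ∼-refl = inj₁ refl

  ∼-sym : ∀ {m} {u v : Vec (Fin k) m} → u ∼ v → v ∼ u
  ∼-sym (inj₁ refl) = inj₁ refl
  ∼-sym {u = u} (inj₂ refl) = inj₂ (sym (reverse-involutive u))

  ∼-trans : ∀ {m} {u v w : Vec (Fin k) m} → u ∼ v → v ∼ w → u ∼ w
  ∼-trans (inj₁ refl) v∼w         = v∼w
  ∼-trans (inj₂ refl) (inj₁ refl) = inj₂ refl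
  ∼-trans {u = u} (inj₂ refl) (inj₂ refl) = inj₁ (reverse-involutive u)

  ∼-setoid : ℕ → Setoid 0ℓ 0ℓ
  ∼-setoid m = record
    { Carrier       = Vec (Fin k) m
    ; _≈_           = _∼_
    ; isEquivalence = record { refl = ∼-refl ; sym = ∼-sym ; trans = ∼-trans }
    }

  _∈∼_ : ∀ {m} → Vec (Fin k) m → List (Vec (Fin k) m) → Set
  _∈∼_ {m} = SetoidMembership._∈_ (∼-setoid m)

  _∈∼?_ : ∀ {m} (w : Vec (Fin k) m) (L : List (Vec (Fin k) m)) → Dec (w ∈∼ L)
  w ∈∼? L = Any.any? (λ u → (u ≟ w) ⊎-dec (u ≟ reverse w)) L
    where _≟_ = ≡-dec _≟ᶠ_

  ∈∼-resp-∼ : ∀ {m} {L : List (Vec (Fin k) m)} {u v} → u ∼ v → u ∈∼ L → v ∈∼ L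
  ∈∼-resp-∼ {m} = ∈-resp-≈ (∼-setoid m)

  Ends : ∀ {m} → List (Vec (Fin k) m) → Vec (Fin k) (suc m) → Set
  Ends L s = init s ∈∼ L × tail s ∈∼ L

  Ends-resp-∼ : ∀ {m} {L : List (Vec (Fin k) m)} {s t} → s ∼ t → Ends L s → Ends L t
  Ends-resp-∼ (inj₁ refl) ends = ends
  Ends-resp-∼ {s = s} (inj₂ refl) (init∈L , tail∈L) =
    subst (_∈∼ _) (sym (init-reverse s)) (∈∼-resp-∼ (inj₂ refl) tail∈L) ,
    subst (_∈∼ _) (sym (tail-reverse s)) (∈∼-resp-∼ (inj₂ refl) init∈L)

  palindrome⇒init∼tail : ∀ {m} {s : Vec (Fin k) (suc m)} → s ≡ reverse s → init s ∼ tail s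
  palindrome⇒init∼tail {s = s} s≡sᴿ = inj₂ (trans (cong tail s≡sᴿ) (tail-reverse s))

  non-palindrome⇒orientation-∉ : ∀ {m} {L : List (Vec (Fin k) m)} {s} →
    SetoidUnique.Unique (∼-setoid m) L → s ≢ reverse s → ∃ λ t → s ∼ t × t ∉ L
  non-palindrome⇒orientation-∉ {m} {L} {s} L-distinct s≢sᴿ with s ∈? L
    where open import Data.List.Membership.DecPropositional (≡-dec _≟ᶠ_) using (_∈?_)
  ... | no  s∉L = s , ∼-refl , s∉L
  ... | yes s∈L = reverse s , inj₂ refl ,
                  λ sᴿ∈L → s≢sᴿ (unique-∈-≈⇒≡ (∼-setoid m) L-distinct s∈L sᴿ∈L (inj₂ refl))

  IsFactor-resp-∼ : ∀ {x : Seq k} → ReversalClosed x → ∀ {m} {s t : Vec (Fin k) m} →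
    IsFactor x s → s ∼ t → IsFactor x t
  IsFactor-resp-∼ _  s-factor (inj₁ refl) = s-factor
  IsFactor-resp-∼ rc s-factor (inj₂ refl) = rc _ _ s-factor

  init-block : ∀ (x : Seq k) i n → init (block x i (suc n)) ≡ block x i n
  init-block x i n = trans (init-tabulate (λ j → x (i + toℕ j)))
                           (tabulate-cong λ j → cong (λ t → x (i + t)) (toℕ-inject₁ j))

  tail-block : ∀ (x : Seq k) i n → tail (block x i (suc n)) ≡ block x (suc i) n
  tail-block x i n = tabulate-cong λ j → cong x (+-suc i (toℕ j))

module SpanningTrees {k} (x : Seq k) (rc : ReversalClosed x) (n : ℕ)
  (reps : List (Vec (Fin k) (suc n))) (reps-distinct : SetoidUnique.Unique (∼-setoid (suc n)) reps) where

  vertex : ℕ → Vec (Fin k) n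
  vertex i = block x i n

  edge : ℕ → Vec (Fin k) (suc n)
  edge i = block x i (suc n)

  record SpanningTree (N : ℕ) : Set where
    field
      vertices        : List (Vec (Fin k) n)
      edges           : List (Vec (Fin k) (suc n))
      vertices-length : length vertices ≡ suc (length edges)
      vertices-cover  : ∀ {i} → i ≤ N → vertex i ∈∼ vertices
      edges-unique    : Unique edges
      edges-∉-reps    : All (_∉ reps) edges
      edges-factors   : All (IsFactor x) edges
      edges-ends      : All (Ends vertices) edges

  revisit : ∀ {N} (T : SpanningTree N) → vertex (suc N) ∈∼ SpanningTree.vertices T → SpanningTree (suc N)
  revisit T old = record
    { vertices = vertices ; edges = edges ; vertices-length = vertices-length
    ; vertices-cover = ≤-suc-extend vertices-cover old
    ; edges-unique = edges-unique ; edges-∉-reps = edges-∉-reps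
    ; edges-factors = edges-factors ; edges-ends = edges-ends }
    where open SpanningTree T

  palindromic-edge⇒vertices-∼ : ∀ {N} → edge N ≡ reverse (edge N) → vertex N ∼ vertex (suc N)
  palindromic-edge⇒vertices-∼ {N} pal =
    subst₂ _∼_ (init-block x N n) (tail-block x N n) (palindrome⇒init∼tail pal)

  discover : ∀ {N} (T : SpanningTree N) → ¬ vertex (suc N) ∈∼ SpanningTree.vertices T → SpanningTree (suc N)
  discover {N} T new
    with non-palindrome⇒orientation-∉ reps-distinct (λ pal →
           new (∈∼-resp-∼ (palindromic-edge⇒vertices-∼ pal) (SpanningTree.vertices-cover T ≤-refl)))
  ... | t , edge∼t , t∉reps = record
    { vertices        = vertex (suc N) ∷ vertices
    ; edges           = t ∷ edges
    ; vertices-length = cong suc vertices-length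
    ; vertices-cover  = ≤-suc-extend (λ i≤N → there (vertices-cover i≤N)) (here ∼-refl)
    ; edges-unique    = All.map t-new edges-ends ∷ edges-unique
    ; edges-∉-reps    = t∉reps ∷ edges-∉-reps
    ; edges-factors   = IsFactor-resp-∼ {x = x} rc (N , refl) edge∼t ∷ edges-factors
    ; edges-ends      = Ends-resp-∼ edge∼t edge-ends ∷ All.map (λ (a , b) → there a , there b) edges-ends
    }
    where
      open SpanningTree T

      edge-ends : Ends (vertex (suc N) ∷ vertices) (edge N)
      edge-ends = there (subst (_∈∼ vertices) (sym (init-block x N n)) (vertices-cover ≤-refl)) ,
                  here (inj₁ (sym (tail-block x N n)))

      t-new : ∀ {e} → Ends vertices e → t ≢ e
      t-new e-ends refl =
        new (subst (_∈∼ vertices) (tail-block x N n) (proj₂ (Ends-resp-∼ (∼-sym edge∼t) e-ends)))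

  explore : ∀ N → SpanningTree N
  explore zero = record
    { vertices = [ vertex 0 ] ; edges = [] ; vertices-length = refl
    ; vertices-cover = λ { z≤n → here ∼-refl }
    ; edges-unique = [] ; edges-∉-reps = [] ; edges-factors = [] ; edges-ends = [] }
  explore (suc N) with vertex (suc N) ∈∼? SpanningTree.vertices (explore N)
  ... | yes old = revisit (explore N) old
  ... | no  new = discover (explore N) new

proposition3p14 : ∀ k (x : Seq k) → ReversalClosed x →
    ∀ n a b c → ReversalComplexity x (suc n) a → ReversalComplexity x n b →
    FactorComplexity x (suc n) c → a + b ≤ c + 1
proposition3p14 k x rc n _ _ _ (reps , refl , reps-distinct , reps-factors , _)
                               (repsₙ , refl , repsₙ-distinct , repsₙ-factors , _)
                               (factors , refl , _ , factors-complete) = begin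
  length reps + length repsₙ          ≤⟨ +-monoʳ-≤ (length reps) repsₙ≤1+edges ⟩
  length reps + suc (length edges)    ≡⟨ +-suc (length reps) (length edges) ⟩
  suc (length reps + length edges)    ≡⟨ cong suc (length-++ reps) ⟨
  suc (length (reps ++ edges))        ≤⟨ s≤s reps++edges≤factors ⟩
  suc (length factors)                ≡⟨ +-comm 1 (length factors) ⟩
  length factors + 1                  ∎
  where
    open ≤-Reasoning
    open SpanningTrees x rc n reps reps-distinct
    open SpanningTree (explore (proj₁ (witnesses-bounded repsₙ repsₙ-factors)))

    repsₙ≤1+edges : length repsₙ ≤ suc (length edges)
    repsₙ≤1+edges = subst (length repsₙ ≤_) vertices-length
      (unique-⊆⇒length-≤ (∼-setoid n) repsₙ-distinct
        (All.map (λ (i , i≤N , w≡vertex) → subst (_∈∼ vertices) (sym w≡vertex) (vertices-cover i≤N))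
                 (proj₂ (witnesses-bounded repsₙ repsₙ-factors))))

    reps++edges≤factors : length (reps ++ edges) ≤ length factors
    reps++edges≤factors = unique-⊆⇒length-≤ (≡.setoid _)
      (Unique.++⁺ (AllPairs.map (λ { u≁v refl → u≁v ∼-refl }) reps-distinct) edges-unique
                  (λ (w∈reps , w∈edges) → All.lookup edges-∉-reps w∈edges w∈reps))
      (++⁺ (All.map from reps-factors) (All.map from edges-factors))
      where from = λ {w} → Equivalence.from (factors-complete w)
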